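{- Let $\mathcal C$ be an identity type category and $(\Gamma,r_i)$ a reflexive globular context in $\mathcal C$. Let $P\subset[\Gamma,\Gamma]$ be the suboperad whose operations of shape $\pi\in(T1)_n$ are those $(f_n;f_{n-1},g_{n-1};\dots;f_0,g_0)\in[\Gamma,\Gamma]_\pi$ with $f_j\circ r_{\partial^{n-j}\pi}=g_j\circ r_{\partial^{n-j}\pi}=r_{\iota_j}$ for all $j$ (identifying $\Gamma^{\iota_j}$ with $\Gamma_j$). Then $P$ is normalised and contractible.
   Context: Identity type category: a category $\mathcal C$ with classes $\mathcal I,\mathcal P$ of maps such that: $\mathcal C$ has a terminal object $1$ and each $A\to1$ is in $\mathcal P$; both classes contain identities and are closed under composition; pullbacks of $\mathcal P$-maps along arbitrary maps exist and are $\mathcal P$-maps; the pullback of an $\mathcal I$-map along a $\mathcal P$-map is an $\mathcal I$-map; every commutative square $g i=p f$ with $i\in\mathcal I$, $p\in\mathcal P$ has a diagonal $j$ with $ji=f$, $pj=g$; for every $\mathcal P$-map $p\colon C\to D$ the diagonal $C\to C\times_DC$ factors as $e\circ r$ with $r\in\mathcal I$, $e\in\mathcal P$. For $X\in\mathcal C$, $\mathcal C_X$ is the category of $\mathcal P$-maps into $X$ and commuting triangles (again an identity type category). Globular context in $\mathcal C$: objects $\Gamma_n$ and maps $s,t\colon\Gamma_{n+1}\to\Gamma_n$ with $ss=st$, $ts=tt$, such that for $n\ge1$, $(s,t)\colon\Gamma_n\to B_n\Gamma$ is a $\mathcal P$-map, where $B_1\Gamma=\Gamma_0\times\Gamma_0$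 and $B_{n+1}\Gamma=\Gamma_n\times_{B_n\Gamma}\Gamma_n$. It is reflexive if equipped with $\mathcal I$-maps $r_n\colon\Gamma_n\to\Gamma_{n+1}$ with $sr_n=tr_n=\mathrm{id}$. $\Gamma_{+1}$ is the globular context in $\mathcal C_{\Gamma_0\times\Gamma_0}$ with $(\Gamma_{+1})_n=\Gamma_{n+1}$; with $(r_{+1})_n=r_{n+1}$ it is reflexive. Pasting diagrams: $(T1)_0=\{\star\}$, $(T1)_{n+1}$ = finite tuples $(\pi_1,\dots,\pi_k)$, $k\ge0$, of elements of $(T1)_n$; $\partial\pi=\star$ for $\pi\in(T1)_1$, $\partial(\pi_1,\dots,\pi_k)=(\partial\pi_1,\dots,\partial\pi_k)$ otherwise; $\iota_0=\star$, $\iota_{n+1}=(\iota_n)$. For $\pi\in(T1)_n$: $\Gamma^\star=\Gamma_0$; for $\pi=(\pi_1,\dots,\pi_k)$, form $(\Gamma_{+1})^{\pi_i}$ in $\mathcal C_{\Gamma_0\times\Gamma_0}$ (yielding $\mathcal P$-maps $s,t\colon(\Gamma_{+1})^{\pi_i}\to\Gamma_0$), and let $\Gamma^\pi$ be the limit of $\Gamma_0\xleftarrow{s}(\Gamma_{+1})^{\pi_1}\xrightarrow{t}\Gamma_0\xleftarrow{s}\cdots\xrightarrow{t}\Gamma_0$. Maps $\sigma,\tau\colon\Gamma^\pi\to\Gamma^{\partial\pi}$: for $\pi\in(T1)_1$ the projections to the leftmost/rightmost $\Gamma_0$; otherwise induced from $\sigma,\tau\colon(\Gamma_{+1})^{\pi_i}\to(\Gamma_{+1})^{\partial\pi_i}$.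 One has $\Gamma^{\iota_n}\cong\Gamma_n$. Pointings $r_\pi\colon\Gamma_0\to\Gamma^\pi$: $r_\star=\mathrm{id}_{\Gamma_0}$; for $\pi=(\pi_1,\dots,\pi_k)$, let $r'_{\pi_i}\colon\Gamma_1\to(\Gamma_{+1})^{\pi_i}$ be the pointing for $\pi_i$ of the reflexive globular context $\Gamma_{+1}$ in $\mathcal C_{\Gamma_0\times\Gamma_0}$; the maps $r'_{\pi_i}\circ r_0\colon\Gamma_0\to(\Gamma_{+1})^{\pi_i}$ form a cone over the diagram defining $\Gamma^\pi$, and $r_\pi$ is the induced map. Globular operads: $T$ is the free strict $\omega$-category monad on globular sets, $T1$ the globular set of pasting diagrams above. A globular operad is a monad $P$ on globular sets with a cartesian monad morphism $\rho\colon P\Rightarrow T$; $P_\pi$ is the set of $n$-cells of $P1$ over $\pi$, with $s,t\colon P_\pi\to P_{\partial\pi}$. $P$ is normalised if $P_\star$ is a singleton; contractible if for $\pi\in(T1)_1$ and any $\theta_1,\theta_2\in P_\star$, and for $\pi\in(T1)_n$ ($n>1$) and any $\theta_1,\theta_2\in P_{\partial\pi}$ with $s\theta_1=s\theta_2$, $t\theta_1=t\theta_2$, there is $\phi\in P_\pi$ with $s\phi=\theta_1$, $t\phi=\theta_2$. Endomorphism operad $[\Gamma,\Gamma]$: $[\Gamma,\Gamma]_\pi$ ($\pi\in(T1)_n$) is the set of families $f_n\colon\Gamma^\pi\to\Gamma_n$ and, for $0\le j<n$, $f_j,g_j\colon\Gamma^{\partial^{n-j}\pi}\to\Gamma_j$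 (put $g_n=f_n$) with $sf_{j+1}=sg_{j+1}=f_j\sigma$ and $tf_{j+1}=tg_{j+1}=g_j\tau$; source/target take the subfamily headed by $f_{n-1}$, resp. $g_{n-1}$; identities are identity maps; substitution is that of Batanin's endomorphism operad of the globular object $(\Gamma_n)_n$ in the monoidal globular category whose $n$-cells are generic-$n$-span-shaped diagrams of $\mathcal P$-maps in $\mathcal C$, composed by pullback. The displayed subcollection $P$ is closed under identities and substitution, hence a suboperad. -}

module Defs where

open import Level using (Level; _⊔_) renaming (suc to lsuc)
open import Data.Nat using (ℕ; zero; suc)
open import Data.List using (List; []; _∷_)
open import Data.Product using (Σ; _×_; _,_; proj₁; proj₂)
open import Relation.Binary using (Rel; IsEquivalence)

record Category (o ℓ e : Level) : Set (lsuc (o ⊔ ℓ ⊔ e)) where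
  infixr 9 _∘_
  infix 4 _≈_
  field
    Obj : Set o
    _⇒_ : Obj → Obj → Set ℓ
    _≈_ : ∀ {A B} → Rel (A ⇒ B) e
    id : ∀ {A} → A ⇒ A
    _∘_ : ∀ {A B C} → B ⇒ C → A ⇒ B → A ⇒ C
    ≈-equiv : ∀ {A B} → IsEquivalence (_≈_ {A} {B})
    ∘-resp-≈ : ∀ {A B C} {f h : B ⇒ C} {g i : A ⇒ B} → f ≈ h → g ≈ i → f ∘ g ≈ h ∘ i
    assoc : ∀ {A B C D} {f : A ⇒ B} {g : B ⇒ C} {h : C ⇒ D} → (h ∘ g) ∘ f ≈ h ∘ (g ∘ f)
    identityˡ : ∀ {A B} {f : A ⇒ B} → id ∘ f ≈ f
    identityʳ : ∀ {A B} {f : A ⇒ B} → f ∘ id ≈ f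

-- Pasting diagrams  T1

data Pd : ℕ → Set where
  ⋆ : Pd zero
  ⟦_⟧ : ∀ {n} → List (Pd n) → Pd (suc n)

mutual
  ∂ : ∀ {n} → Pd (suc n) → Pd n
  ∂ {zero} ⟦ _ ⟧ = ⋆
  ∂ {suc n} ⟦ πs ⟧ = ⟦ ∂s πs ⟧

  ∂s : ∀ {n} → List (Pd (suc n)) → List (Pd n)
  ∂s [] = []
  ∂s (π ∷ πs) = ∂ π ∷ ∂s πs

ι : (n : ℕ) → Pd n
ι zero = ⋆
ι (suc n) = ⟦ ι n ∷ [] ⟧

module _ {o ℓ e : Level} (C : Category o ℓ e) where
  open Category C

  private
    module E {A B} = IsEquivalence (≈-equiv {A} {B})

  infixr 2 _≈⟨_⟩_
  infix 3 _∎
  _≈⟨_⟩_ : ∀ {A B} (f : A ⇒ B) {g h : A ⇒ B} → f ≈ g → g ≈ h → f ≈ h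
  f ≈⟨ p ⟩ q = E.trans p q
  _∎ : ∀ {A B} (f : A ⇒ B) → f ≈ f
  f ∎ = E.refl

  record IsPullback {A B D Q : Obj} (f : A ⇒ D) (g : B ⇒ D)
                    (p₁ : Q ⇒ A) (p₂ : Q ⇒ B) : Set (o ⊔ ℓ ⊔ e) where
    field
      commute : f ∘ p₁ ≈ g ∘ p₂
      universal : ∀ {X} {h₁ : X ⇒ A} {h₂ : X ⇒ B} → f ∘ h₁ ≈ g ∘ h₂ → X ⇒ Q
      p₁∘universal : ∀ {X} {h₁ : X ⇒ A} {h₂ : X ⇒ B} (eq : f ∘ h₁ ≈ g ∘ h₂) →
                     p₁ ∘ universal eq ≈ h₁
      p₂∘universal : ∀ {X} {h₁ : X ⇒ A} {h₂ : X ⇒ B} (eq : f ∘ h₁ ≈ g ∘ h₂) →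
                     p₂ ∘ universal eq ≈ h₂
      unique : ∀ {X} {h₁ : X ⇒ A} {h₂ : X ⇒ B} (eq : f ∘ h₁ ≈ g ∘ h₂) (u : X ⇒ Q) →
               p₁ ∘ u ≈ h₁ → p₂ ∘ u ≈ h₂ → u ≈ universal eq

  record Pullback {A B D : Obj} (f : A ⇒ D) (g : B ⇒ D) : Set (o ⊔ ℓ ⊔ e) where
    field
      apex : Obj
      p₁ : apex ⇒ A
      p₂ : apex ⇒ B
      isPullback : IsPullback f g p₁ p₂
    open IsPullback isPullback public

  swapPB : ∀ {A B D Q} {f : A ⇒ D} {g : B ⇒ D} {p₁ : Q ⇒ A} {p₂ : Q ⇒ B} →
           IsPullback f g p₁ p₂ → IsPullback g f p₂ p₁
  swapPB pb = record
    { commute = E.sym commute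
    ; universal = λ eq → universal (E.sym eq)
    ; p₁∘universal = λ eq → p₂∘universal (E.sym eq)
    ; p₂∘universal = λ eq → p₁∘universal (E.sym eq)
    ; unique = λ eq u q₁ q₂ → unique (E.sym eq) u q₂ q₁
    }
    where open IsPullback pb

  record IdTypeCat (p : Level) : Set (o ⊔ ℓ ⊔ e ⊔ lsuc p) where
    field
      I P : ∀ {A B} → A ⇒ B → Set p
      I-resp : ∀ {A B} {f g : A ⇒ B} → f ≈ g → I f → I g
      P-resp : ∀ {A B} {f g : A ⇒ B} → f ≈ g → P f → P g
      ⊤ : Obj
      ! : ∀ {A} → A ⇒ ⊤
      !-unique : ∀ {A} (f : A ⇒ ⊤) → f ≈ !
      !-P : ∀ {A} → P (! {A})
      I-id : ∀ {A} → I (id {A})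
      P-id : ∀ {A} → P (id {A})
      I-∘ : ∀ {A B D} {f : B ⇒ D} {g : A ⇒ B} → I f → I g → I (f ∘ g)
      P-∘ : ∀ {A B D} {f : B ⇒ D} {g : A ⇒ B} → P f → P g → P (f ∘ g)
      pullback : ∀ {A B D} (q : A ⇒ D) → P q → (f : B ⇒ D) → Pullback q f
      P-stable : ∀ {A B D Q} {q : A ⇒ D} {f : B ⇒ D} {q₁ : Q ⇒ A} {q₂ : Q ⇒ B} →
                 P q → IsPullback q f q₁ q₂ → P q₂
      I-stable : ∀ {A B D Q} {i : A ⇒ D} {q : B ⇒ D} {q₁ : Q ⇒ A} {q₂ : Q ⇒ B} →
                 I i → P q → IsPullback i q q₁ q₂ → I q₂
      lift : ∀ {A B D E} {i : A ⇒ B} {q : D ⇒ E} {f : A ⇒ D} {g : B ⇒ E} →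
             I i → P q → g ∘ i ≈ q ∘ f →
             Σ (B ⇒ D) λ j → (j ∘ i ≈ f) × (q ∘ j ≈ g)
      factor : ∀ {X D} (q : X ⇒ D) (qP : P q) →
               let pb = pullback q qP q in
               Σ Obj λ M → Σ (X ⇒ M) λ r → Σ (M ⇒ Pullback.apex pb) λ ε →
                 I r × P ε × (ε ∘ r ≈ Pullback.universal pb {h₁ = id} {h₂ = id} E.refl)

  module _ {p : Level} (𝕀 : IdTypeCat p) where
    open IdTypeCat 𝕀

    -- B n stands for B_{n+1}Γ; it is given together
    -- with its pullback structure:  B_1Γ = Γ₀ × Γ₀ and
    -- B_{n+2}Γ = Γ_{n+1} ×_{B_{n+1}Γ} Γ_{n+1};  ⟨s,t⟩ n : Γ_{n+1} → B_{n+1}Γ.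

    record GlobularContext : Set (o ⊔ ℓ ⊔ e ⊔ p) where
      field
        Γ : ℕ → Obj
        s t : ∀ {n} → Γ (suc n) ⇒ Γ n
        ss≈st : ∀ {n} → s {n} ∘ s {suc n} ≈ s ∘ t
        ts≈tt : ∀ {n} → t {n} ∘ s {suc n} ≈ t ∘ t
        B : ℕ → Obj
        pr₁ pr₂ : ∀ n → B n ⇒ Γ n
        B-zero : IsPullback (! {Γ 0}) (! {Γ 0}) (pr₁ 0) (pr₂ 0)
        ⟨s,t⟩ : ∀ n → Γ (suc n) ⇒ B n
        pr₁∘⟨s,t⟩ : ∀ n → pr₁ n ∘ ⟨s,t⟩ n ≈ s
        pr₂∘⟨s,t⟩ : ∀ n → pr₂ n ∘ ⟨s,t⟩ n ≈ t
        B-suc : ∀ n → IsPullback (⟨s,t⟩ n) (⟨s,t⟩ n) (pr₁ (suc n)) (pr₂ (suc n))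
        ⟨s,t⟩-P : ∀ n → P (⟨s,t⟩ n)

    record Reflexive (𝔾 : GlobularContext) : Set (ℓ ⊔ e ⊔ p) where
      open GlobularContext 𝔾
      field
        r : ∀ n → Γ n ⇒ Γ (suc n)
        r-I : ∀ n → I (r n)
        s∘r : ∀ n → s ∘ r n ≈ id
        t∘r : ∀ n → t ∘ r n ≈ id

    -- Underlying data of a reflexive globular context used to build Γ^π;
    -- shifting it gives (the underlying data in C of) Γ_{+1}.

    record Tower : Set (o ⊔ ℓ ⊔ e ⊔ p) where
      field
        obj : ℕ → Obj
        s t : ∀ {n} → obj (suc n) ⇒ obj n
        s-P : ∀ {n} → P (s {n})
        t-P : ∀ {n} → P (t {n})
        ss≈st : ∀ {n} → s {n} ∘ s {suc n} ≈ s ∘ t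
        ts≈tt : ∀ {n} → t {n} ∘ s {suc n} ≈ t ∘ t
        r : ∀ {n} → obj n ⇒ obj (suc n)
        s∘r : ∀ {n} → s ∘ r {n} ≈ id
        t∘r : ∀ {n} → t ∘ r {n} ≈ id

    shift : Tower → Tower
    shift T = record
      { obj = λ n → obj (suc n) ; s = s ; t = t ; s-P = s-P ; t-P = t-P
      ; ss≈st = ss≈st ; ts≈tt = ts≈tt ; r = r ; s∘r = s∘r ; t∘r = t∘r }
      where open Tower T

    tower : (𝔾 : GlobularContext) → Reflexive 𝔾 → Tower
    tower 𝔾 R = record
      { obj = Γ ; s = s ; t = t ; s-P = λ {n} → sP n ; t-P = λ {n} → tP n
      ; ss≈st = ss≈st ; ts≈tt = ts≈tt ; r = λ {n} → Reflexive.r R n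
      ; s∘r = λ {n} → Reflexive.s∘r R n ; t∘r = λ {n} → Reflexive.t∘r R n }
      where
        open GlobularContext 𝔾
        pr₂P : ∀ n → P (pr₂ n)
        pr₂P zero = P-stable !-P B-zero
        pr₂P (suc n) = P-stable (⟨s,t⟩-P n) (B-suc n)
        pr₁P : ∀ n → P (pr₁ n)
        pr₁P zero = P-stable !-P (swapPB B-zero)
        pr₁P (suc n) = P-stable (⟨s,t⟩-P n) (swapPB (B-suc n))
        sP : ∀ n → P (s {n})
        sP n = P-resp (pr₁∘⟨s,t⟩ n) (P-∘ (pr₁P n) (⟨s,t⟩-P n))
        tP : ∀ n → P (t {n})
        tP n = P-resp (pr₂∘⟨s,t⟩ n) (P-∘ (pr₂P n) (⟨s,t⟩-P n))

    -- Γ^π as an iterated pullback (limit of the zig-zag), with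
    --   base : Γ^π → Γ₀  the leftmost vertex.

    mutual
      G : ∀ {n} → Tower → Pd n → Obj
      base : ∀ {n} (T : Tower) (π : Pd n) → G T π ⇒ Tower.obj T 0
      base-P : ∀ {n} (T : Tower) (π : Pd n) → P (base T π)
      Lim : ∀ {n} → Tower → List (Pd n) → Obj
      lbase : ∀ {n} (T : Tower) (πs : List (Pd n)) → Lim T πs ⇒ Tower.obj T 0
      lbase-P : ∀ {n} (T : Tower) (πs : List (Pd n)) → P (lbase T πs)
      PB : ∀ {n} (T : Tower) (π : Pd n) (πs : List (Pd n)) →
           Pullback (lbase T πs) (Tower.t T ∘ base (shift T) π)

      G T ⋆ = Tower.obj T 0
      G T ⟦ πs ⟧ = Lim T πs

      base T ⋆ = id
      base T ⟦ πs ⟧ = lbase T πs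

      base-P T ⋆ = P-id
      base-P T ⟦ πs ⟧ = lbase-P T πs

      Lim T [] = Tower.obj T 0
      Lim T (π ∷ []) = G (shift T) π
      Lim T (π ∷ πs@(_ ∷ _)) = Pullback.apex (PB T π πs)

      PB T π πs = pullback (lbase T πs) (lbase-P T πs) (Tower.t T ∘ base (shift T) π)

      lbase T [] = id
      lbase T (π ∷ []) = Tower.s T ∘ base (shift T) π
      lbase T (π ∷ πs@(_ ∷ _)) = (Tower.s T ∘ base (shift T) π) ∘ Pullback.p₂ (PB T π πs)

      lbase-P T [] = P-id
      lbase-P T (π ∷ []) = P-∘ (Tower.s-P T) (base-P (shift T) π)
      lbase-P T (π ∷ πs@(_ ∷ _)) =
        P-∘ (P-∘ (Tower.s-P T) (base-P (shift T) π))
            (P-stable (lbase-P T πs) (Pullback.isPullback (PB T π πs)))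

    -- rightmost vertex
    rbase : ∀ {n} (T : Tower) (πs : List (Pd n)) → Lim T πs ⇒ Tower.obj T 0
    rbase T [] = id
    rbase T (π ∷ []) = Tower.t T ∘ base (shift T) π
    rbase T (π ∷ πs@(_ ∷ _)) = rbase T πs ∘ Pullback.p₁ (PB T π πs)

    private
      infixr 4 _⟩∘⟨_
      _⟩∘⟨_ : ∀ {A B D} {f h : B ⇒ D} {g i : A ⇒ B} → f ≈ h → g ≈ i → f ∘ g ≈ h ∘ i
      _⟩∘⟨_ = ∘-resp-≈
      rfl : ∀ {A B} {f : A ⇒ B} → f ≈ f
      rfl = E.refl
      sy : ∀ {A B} {f g : A ⇒ B} → f ≈ g → g ≈ f
      sy = E.sym
      tr : ∀ {A B} {f g h : A ⇒ B} → f ≈ g → g ≈ h → f ≈ h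
      tr = E.trans
      sassoc : ∀ {A B D F} {f : A ⇒ B} {g : B ⇒ D} {h : D ⇒ F} → h ∘ (g ∘ f) ≈ (h ∘ g) ∘ f
      sassoc = E.sym assoc

    -- all vertices of the zig-zag have the same image under s and t
    vert-s : ∀ {n} (T : Tower) (πs : List (Pd n)) →
             Tower.s T ∘ rbase (shift T) πs ≈ Tower.s T ∘ lbase (shift T) πs
    vert-s T [] = rfl
    vert-s T (π ∷ []) = tr sassoc (tr (sy (Tower.ss≈st T) ⟩∘⟨ rfl) assoc)
    vert-s T (π ∷ πs@(_ ∷ _)) =
      tr sassoc (tr (vert-s T πs ⟩∘⟨ rfl) (tr assoc (tr (rfl ⟩∘⟨ Pullback.commute (PB (shift T) π πs))
        (tr sassoc (tr (vert-s T (π ∷ []) ⟩∘⟨ rfl) assoc)))))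

    vert-t : ∀ {n} (T : Tower) (πs : List (Pd n)) →
             Tower.t T ∘ rbase (shift T) πs ≈ Tower.t T ∘ lbase (shift T) πs
    vert-t T [] = rfl
    vert-t T (π ∷ []) = tr sassoc (tr (sy (Tower.ts≈tt T) ⟩∘⟨ rfl) assoc)
    vert-t T (π ∷ πs@(_ ∷ _)) =
      tr sassoc (tr (vert-t T πs ⟩∘⟨ rfl) (tr assoc (tr (rfl ⟩∘⟨ Pullback.commute (PB (shift T) π πs))
        (tr sassoc (tr (vert-t T (π ∷ []) ⟩∘⟨ rfl) assoc)))))

    mutual
      σ : ∀ {n} (T : Tower) (π : Pd (suc n)) → G T π ⇒ G T (∂ π)
      lσ : ∀ {n} (T : Tower) (πs : List (Pd (suc n))) → Lim T πs ⇒ Lim T (∂s πs)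
      σ-base : ∀ {n} (T : Tower) (π : Pd (suc n)) → base T (∂ π) ∘ σ T π ≈ base T π
      lσ-base : ∀ {n} (T : Tower) (πs : List (Pd (suc n))) →
                lbase T (∂s πs) ∘ lσ T πs ≈ lbase T πs
      lσ-eq : ∀ {n} (T : Tower) (π : Pd (suc n)) (πs : List (Pd (suc n))) →
              lbase T (∂s πs) ∘ (lσ T πs ∘ Pullback.p₁ (PB T π πs))
                ≈ (Tower.t T ∘ base (shift T) (∂ π)) ∘ (σ (shift T) π ∘ Pullback.p₂ (PB T π πs))

      σ {zero} T ⟦ πs ⟧ = lbase T πs
      σ {suc n} T ⟦ πs ⟧ = lσ T πs

      lσ T [] = id
      lσ T (π ∷ []) = σ (shift T) π
      lσ T (π ∷ πs@(_ ∷ _)) = Pullback.universal (PB T (∂ π) (∂s πs)) (lσ-eq T π πs)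

      lσ-eq T π πs =
        tr sassoc (tr (lσ-base T πs ⟩∘⟨ rfl) (tr (Pullback.commute (PB T π πs))
          (tr (tr (rfl ⟩∘⟨ sy (σ-base (shift T) π)) sassoc ⟩∘⟨ rfl) assoc)))

      σ-base {zero} T ⟦ πs ⟧ = identityˡ
      σ-base {suc n} T ⟦ πs ⟧ = lσ-base T πs

      lσ-base T [] = identityˡ
      lσ-base T (π ∷ []) = tr assoc (rfl ⟩∘⟨ σ-base (shift T) π)
      lσ-base T (π ∷ πs@(_ ∷ _)) =
        tr assoc (tr (rfl ⟩∘⟨ Pullback.p₂∘universal (PB T (∂ π) (∂s πs)) (lσ-eq T π πs))
          (tr sassoc (tr assoc (rfl ⟩∘⟨ σ-base (shift T) π) ⟩∘⟨ rfl)))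

    mutual
      τ : ∀ {n} (T : Tower) (π : Pd (suc n)) → G T π ⇒ G T (∂ π)
      lτ : ∀ {n} (T : Tower) (πs : List (Pd (suc n))) → Lim T πs ⇒ Lim T (∂s πs)
      τ-base-s : ∀ {n} (T : Tower) (π : Pd (suc n)) →
                 Tower.s T ∘ (base (shift T) (∂ π) ∘ τ (shift T) π) ≈ Tower.s T ∘ base (shift T) π
      τ-base-t : ∀ {n} (T : Tower) (π : Pd (suc n)) →
                 Tower.t T ∘ (base (shift T) (∂ π) ∘ τ (shift T) π) ≈ Tower.t T ∘ base (shift T) π
      lτ-base : ∀ {n} (T : Tower) (πs : List (Pd (suc n))) →
                lbase T (∂s πs) ∘ lτ T πs ≈ lbase T πs
      lτ-eq : ∀ {n} (T : Tower) (π : Pd (suc n)) (πs : List (Pd (suc n))) →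
              lbase T (∂s πs) ∘ (lτ T πs ∘ Pullback.p₁ (PB T π πs))
                ≈ (Tower.t T ∘ base (shift T) (∂ π)) ∘ (τ (shift T) π ∘ Pullback.p₂ (PB T π πs))

      τ {zero} T ⟦ πs ⟧ = rbase T πs
      τ {suc n} T ⟦ πs ⟧ = lτ T πs

      lτ T [] = id
      lτ T (π ∷ []) = τ (shift T) π
      lτ T (π ∷ πs@(_ ∷ _)) = Pullback.universal (PB T (∂ π) (∂s πs)) (lτ-eq T π πs)

      lτ-eq T π πs =
        tr sassoc (tr (lτ-base T πs ⟩∘⟨ rfl) (tr (Pullback.commute (PB T π πs))
          (tr (tr (sy (τ-base-t T π)) sassoc ⟩∘⟨ rfl) assoc)))

      τ-base-s {zero} T ⟦ πs ⟧ = tr (rfl ⟩∘⟨ identityˡ) (vert-s T πs)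
      τ-base-s {suc n} T ⟦ πs ⟧ = rfl ⟩∘⟨ lτ-base (shift T) πs

      τ-base-t {zero} T ⟦ πs ⟧ = tr (rfl ⟩∘⟨ identityˡ) (vert-t T πs)
      τ-base-t {suc n} T ⟦ πs ⟧ = rfl ⟩∘⟨ lτ-base (shift T) πs

      lτ-base T [] = identityˡ
      lτ-base T (π ∷ []) = tr assoc (τ-base-s T π)
      lτ-base T (π ∷ πs@(_ ∷ _)) =
        tr assoc (tr (rfl ⟩∘⟨ Pullback.p₂∘universal (PB T (∂ π) (∂s πs)) (lτ-eq T π πs))
          (tr sassoc (tr assoc (τ-base-s T π) ⟩∘⟨ rfl)))

    mutual
      rp : ∀ {n} (T : Tower) (π : Pd n) → Tower.obj T 0 ⇒ G T π
      lrp : ∀ {n} (T : Tower) (πs : List (Pd n)) → Tower.obj T 0 ⇒ Lim T πs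
      base-rp : ∀ {n} (T : Tower) (π : Pd n) → base T π ∘ rp T π ≈ id
      lbase-lrp : ∀ {n} (T : Tower) (πs : List (Pd n)) → lbase T πs ∘ lrp T πs ≈ id
      lrp-eq : ∀ {n} (T : Tower) (π : Pd n) (πs : List (Pd n)) →
               lbase T πs ∘ lrp T πs ≈ (Tower.t T ∘ base (shift T) π) ∘ (rp (shift T) π ∘ Tower.r T)

      rp T ⋆ = id
      rp T ⟦ πs ⟧ = lrp T πs

      lrp T [] = id
      lrp T (π ∷ []) = rp (shift T) π ∘ Tower.r T
      lrp T (π ∷ πs@(_ ∷ _)) = Pullback.universal (PB T π πs) (lrp-eq T π πs)

      lrp-eq T π πs =
        tr (lbase-lrp T πs) (sy (tr assoc (tr (rfl ⟩∘⟨ tr sassoc (tr (base-rp (shift T) π ⟩∘⟨ rfl) identityˡ))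
          (Tower.t∘r T))))

      base-rp T ⋆ = identityˡ
      base-rp T ⟦ πs ⟧ = lbase-lrp T πs

      lbase-lrp T [] = identityˡ
      lbase-lrp T (π ∷ []) =
        tr assoc (tr (rfl ⟩∘⟨ tr sassoc (tr (base-rp (shift T) π ⟩∘⟨ rfl) identityˡ)) (Tower.s∘r T))
      lbase-lrp T (π ∷ πs@(_ ∷ _)) =
        tr assoc (tr (rfl ⟩∘⟨ Pullback.p₂∘universal (PB T π πs) (lrp-eq T π πs)) 
          (tr assoc (tr (rfl ⟩∘⟨ tr sassoc (tr (base-rp (shift T) π ⟩∘⟨ rfl) identityˡ)) (Tower.s∘r T))))

    -- the identification Γ^{ι_j} ≅ Γ_j (an identity at every stage)
    φι : (T : Tower) (j : ℕ) → G T (ι j) ⇒ Tower.obj T j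
    φι T zero = id
    φι T (suc j) = φι (shift T) j

    -- The endomorphism operad [Γ,Γ] (its sets of operations with source
    -- and target) and the subcollection P of "pointed" operations.

    module Endo (T : Tower) where
      open Tower T using (obj; s; t)

      Γ^ : ∀ {n} → Pd n → Obj
      Γ^ = G T

      rι : (j : ℕ) → obj 0 ⇒ obj j
      rι j = φι T j ∘ rp T (ι j)

      -- Bnd ρ (ρ ∈ (T1)_m): the data (f_m, g_m; f_{m-1}, g_{m-1}; …; f_0, g_0)
      mutual
        data Bnd : ∀ {m} → Pd m → Set (ℓ ⊔ e) where
          bnd₀ : (f g : Γ^ ⋆ ⇒ obj 0) → Bnd ⋆
          bndₛ : ∀ {m} {ρ : Pd (suc m)} (b : Bnd (∂ ρ)) (f g : Γ^ ρ ⇒ obj (suc m)) →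
                 Compat ρ b f → Compat ρ b g → Bnd ρ

        bfst : ∀ {m} {ρ : Pd m} → Bnd ρ → Γ^ ρ ⇒ obj m
        bfst (bnd₀ f g) = f
        bfst (bndₛ b f g _ _) = f

        bsnd : ∀ {m} {ρ : Pd m} → Bnd ρ → Γ^ ρ ⇒ obj m
        bsnd (bnd₀ f g) = g
        bsnd (bndₛ b f g _ _) = g

        Compat : ∀ {m} (ρ : Pd (suc m)) → Bnd (∂ ρ) → Γ^ ρ ⇒ obj (suc m) → Set e
        Compat ρ b h = (s ∘ h ≈ bfst b ∘ σ T ρ) × (t ∘ h ≈ bsnd b ∘ τ T ρ)

      -- [Γ,Γ]_π : families (f_n; f_{n-1}, g_{n-1}; …; f_0, g_0)
      data Op : ∀ {n} → Pd n → Set (ℓ ⊔ e) where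
        op₀ : (f : Γ^ ⋆ ⇒ obj 0) → Op ⋆
        opₛ : ∀ {n} {π : Pd (suc n)} (b : Bnd (∂ π)) (f : Γ^ π ⇒ obj (suc n)) →
              Compat π b f → Op π

      fstOp : ∀ {m} {ρ : Pd m} → Bnd ρ → Op ρ
      fstOp (bnd₀ f g) = op₀ f
      fstOp (bndₛ b f g cf cg) = opₛ b f cf

      sndOp : ∀ {m} {ρ : Pd m} → Bnd ρ → Op ρ
      sndOp (bnd₀ f g) = op₀ g
      sndOp (bndₛ b f g cf cg) = opₛ b g cg

      -- source and target: the subfamilies headed by f_{n-1}, resp. g_{n-1}
      src : ∀ {n} {π : Pd (suc n)} → Op π → Op (∂ π)
      src (opₛ b f c) = fstOp b

      tgt : ∀ {n} {π : Pd (suc n)} → Op π → Op (∂ π)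
      tgt (opₛ b f c) = sndOp b

      BndEq : ∀ {m} {ρ : Pd m} → Bnd ρ → Bnd ρ → Set e
      BndEq (bnd₀ f g) (bnd₀ f' g') = (f ≈ f') × (g ≈ g')
      BndEq (bndₛ b f g _ _) (bndₛ b' f' g' _ _) = BndEq b b' × (f ≈ f') × (g ≈ g')

      OpEq : ∀ {n} {π : Pd n} → Op π → Op π → Set e
      OpEq (op₀ f) (op₀ f') = f ≈ f'
      OpEq (opₛ b f _) (opₛ b' f' _) = BndEq b b' × (f ≈ f')

      -- the defining condition of P:  f_j r_{∂^{n-j}π} = g_j r_{∂^{n-j}π} = r_{ι_j}
      BndOK : ∀ {m} {ρ : Pd m} → Bnd ρ → Set e
      BndOK (bnd₀ f g) = (f ∘ rp T ⋆ ≈ rι 0) × (g ∘ rp T ⋆ ≈ rι 0)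
      BndOK (bndₛ {m} {ρ} b f g _ _) =
        BndOK b × (f ∘ rp T ρ ≈ rι (suc m)) × (g ∘ rp T ρ ≈ rι (suc m))

      OpOK : ∀ {n} {π : Pd n} → Op π → Set e
      OpOK (op₀ f) = f ∘ rp T ⋆ ≈ rι 0
      OpOK (opₛ {n} {π} b f _) = BndOK b × (f ∘ rp T π ≈ rι (suc n))

      PElt : ∀ {n} → Pd n → Set (ℓ ⊔ e)
      PElt π = Σ (Op π) OpOK

      Normalised : Set (ℓ ⊔ e)
      Normalised = Σ (PElt ⋆) λ θ → ∀ (θ' : PElt ⋆) → OpEq (proj₁ θ') (proj₁ θ)

      Contractible : Set (ℓ ⊔ e)
      Contractible =
        (∀ (π : Pd 1) (θ₁ θ₂ : PElt (∂ π)) →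
           Σ (PElt π) λ ϕ → OpEq (src (proj₁ ϕ)) (proj₁ θ₁) × OpEq (tgt (proj₁ ϕ)) (proj₁ θ₂))
        ×
        (∀ {n} (π : Pd (suc (suc n))) (θ₁ θ₂ : PElt (∂ π)) →
           OpEq (src (proj₁ θ₁)) (src (proj₁ θ₂)) → OpEq (tgt (proj₁ θ₁)) (tgt (proj₁ θ₂)) →
           Σ (PElt π) λ ϕ → OpEq (src (proj₁ ϕ)) (proj₁ θ₁) × OpEq (tgt (proj₁ ϕ)) (proj₁ θ₂))

    PointedSuboperadNormalised : (𝔾 : GlobularContext) → Reflexive 𝔾 → Set (ℓ ⊔ e)
    PointedSuboperadNormalised 𝔾 R = Endo.Normalised (tower 𝔾 R)

    PointedSuboperadContractible : (𝔾 : GlobularContext) → Reflexive 𝔾 → Set (ℓ ⊔ e)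
    PointedSuboperadContractible 𝔾 R = Endo.Contractible (tower 𝔾 R)

module Submission where

open import Defs hiding (_≈⟨_⟩_; _∎)
open import Level using (Level)
open import Data.Product using (Σ; _×_; _,_; proj₁; proj₂)
open import Data.Nat using (ℕ; zero; suc)
open import Data.List using (List; []; _∷_)
open import Data.Unit.Polymorphic using (⊤; tt)
open import Relation.Binary using (Setoid; IsEquivalence)
import Relation.Binary.Reasoning.Setoid as SetoidReasoning

-- Normalisation is immediate: P_⋆ consists of the single map r_{ι₀} = id.
-- Contractibility is a lifting argument.  A pointed boundary (f_n, g_n; …) of
-- shape π gives u = (f_n σ, g_n τ) : Γ^π → B_nΓ, and a pointed filler is a
-- diagonal h of the square  (s,t) ∘ r_{ι_{n+1}} = u ∘ r_π  from r_π to (s,t).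
-- It exists (the r's are I-maps, (s,t) is a P-map) once we know, for the
-- iterated pullbacks Γ^π of Defs:
--   (1) σ r_π = r_{∂π} = τ r_π     (the square commutes),
--   (2) σσ = στ and τσ = ττ        (u exists in dimension ≥ 2),
--   (3) r_π is an I-map             (the diagonal exists).

module CategoryLemmas {o ℓ e : Level} (C : Category o ℓ e) where
  open Category C

  homSetoid : Obj → Obj → Setoid ℓ e
  homSetoid A B = record { Carrier = A ⇒ B ; _≈_ = _≈_ ; isEquivalence = ≈-equiv }

  module HomReasoning {A B : Obj} = SetoidReasoning (homSetoid A B)
  open HomReasoning public
  module HomEquiv {A B : Obj} = IsEquivalence (≈-equiv {A} {B})
  open HomEquiv public using (refl; sym; trans)

  infixr 4 _⟩∘⟨_ refl⟩∘⟨_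
  infixl 5 _⟩∘⟨refl

  _⟩∘⟨_ : ∀ {A B D} {f h : B ⇒ D} {g i : A ⇒ B} → f ≈ h → g ≈ i → f ∘ g ≈ h ∘ i
  _⟩∘⟨_ = ∘-resp-≈

  refl⟩∘⟨_ : ∀ {A B D} {f : B ⇒ D} {g i : A ⇒ B} → g ≈ i → f ∘ g ≈ f ∘ i
  refl⟩∘⟨ e = refl ⟩∘⟨ e

  _⟩∘⟨refl : ∀ {A B D} {f h : B ⇒ D} {g : A ⇒ B} → f ≈ h → f ∘ g ≈ h ∘ g
  e ⟩∘⟨refl = e ⟩∘⟨ refl

  pullˡ : ∀ {A B D F} {a : D ⇒ F} {b : B ⇒ D} {c : B ⇒ F} {f : A ⇒ B} →
          a ∘ b ≈ c → a ∘ (b ∘ f) ≈ c ∘ f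
  pullˡ e = trans (sym assoc) (e ⟩∘⟨refl)

  pullʳ : ∀ {A B D F} {a : D ⇒ F} {b : B ⇒ D} {f : A ⇒ B} {c : A ⇒ D} →
          b ∘ f ≈ c → (a ∘ b) ∘ f ≈ a ∘ c
  pullʳ e = trans assoc (refl⟩∘⟨ e)

  cancelˡ : ∀ {A B D} {a : D ⇒ B} {b : B ⇒ D} {f : A ⇒ B} → a ∘ b ≈ id → a ∘ (b ∘ f) ≈ f
  cancelˡ e = trans (pullˡ e) identityˡ

  pullback-jointly-monic : ∀ {A B D Q} {f : A ⇒ D} {g : B ⇒ D} {p₁ : Q ⇒ A} {p₂ : Q ⇒ B} →
                           IsPullback C f g p₁ p₂ →
                           ∀ {X} {u v : X ⇒ Q} → p₁ ∘ u ≈ p₁ ∘ v → p₂ ∘ u ≈ p₂ ∘ v → u ≈ v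
  pullback-jointly-monic {f = f} {g} {p₁} {p₂} pb {u = u} {v} e₁ e₂ =
    trans (unique cone u e₁ e₂) (sym (unique cone v refl refl))
    where
      open IsPullback pb
      cone : f ∘ (p₁ ∘ v) ≈ g ∘ (p₂ ∘ v)
      cone = trans (sym assoc) (trans (commute ⟩∘⟨refl) assoc)

  pair : ∀ {A B D Q X} {f : A ⇒ D} {g : B ⇒ D} {p₁ : Q ⇒ A} {p₂ : Q ⇒ B} →
         IsPullback C f g p₁ p₂ → {x : X ⇒ A} {y : X ⇒ B} → f ∘ x ≈ g ∘ y →
         Σ (X ⇒ Q) λ u → (p₁ ∘ u ≈ x) × (p₂ ∘ u ≈ y)
  pair pb eq = universal eq , p₁∘universal eq , p₂∘universal eq
    where open IsPullback pb

  universal-legs : ∀ {A B D X} {f : A ⇒ D} {g : B ⇒ D} (pb : Pullback C f g)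
                     {h₁ : X ⇒ A} {h₂ : X ⇒ B} (eq : f ∘ h₁ ≈ g ∘ h₂) →
                   (Pullback.p₁ pb ∘ Pullback.universal pb eq ≈ h₁) ×
                   (Pullback.p₂ pb ∘ Pullback.universal pb eq ≈ h₂)
  universal-legs pb eq = Pullback.p₁∘universal pb eq , Pullback.p₂∘universal pb eq

  Componentwise : ∀ {Q A B Q' A' B'} → Q ⇒ A → Q ⇒ B → Q' ⇒ A' → Q' ⇒ B' →
                  Q ⇒ Q' → A ⇒ A' → B ⇒ B' → Set e
  Componentwise q₁ q₂ q₁' q₂' φ ψ χ = (q₁' ∘ φ ≈ ψ ∘ q₁) × (q₂' ∘ φ ≈ χ ∘ q₂)

  glue-squares : ∀ {Q Q' Q'' A A' A''} {a : Q ⇒ A} {a' : Q' ⇒ A'} {a'' : Q'' ⇒ A''}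
                   {φ : Q ⇒ Q'} {φ' : Q' ⇒ Q''} {ψ : A ⇒ A'} {ψ' : A' ⇒ A''} →
                 a'' ∘ φ' ≈ ψ' ∘ a' → a' ∘ φ ≈ ψ ∘ a → a'' ∘ (φ' ∘ φ) ≈ (ψ' ∘ ψ) ∘ a
  glue-squares e' e = trans (pullˡ e') (trans (pullʳ e) (sym assoc))

  componentwise-∘ : ∀ {Q A B Q' A' B' Q'' A'' B''}
                      {q₁ : Q ⇒ A} {q₂ : Q ⇒ B} {q₁' : Q' ⇒ A'} {q₂' : Q' ⇒ B'}
                      {q₁'' : Q'' ⇒ A''} {q₂'' : Q'' ⇒ B''}
                      {φ : Q ⇒ Q'} {ψ : A ⇒ A'} {χ : B ⇒ B'}
                      {φ' : Q' ⇒ Q''} {ψ' : A' ⇒ A''} {χ' : B' ⇒ B''} →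
                    Componentwise q₁' q₂' q₁'' q₂'' φ' ψ' χ' →
                    Componentwise q₁ q₂ q₁' q₂' φ ψ χ →
                    Componentwise q₁ q₂ q₁'' q₂'' (φ' ∘ φ) (ψ' ∘ ψ) (χ' ∘ χ)
  componentwise-∘ (e₁' , e₂') (e₁ , e₂) = glue-squares e₁' e₁ , glue-squares e₂' e₂

  componentwise-unique : ∀ {Q A B Q' A' B' D'} {f : A' ⇒ D'} {g : B' ⇒ D'}
                           {q₁ : Q ⇒ A} {q₂ : Q ⇒ B} {q₁' : Q' ⇒ A'} {q₂' : Q' ⇒ B'}
                           {φ φ' : Q ⇒ Q'} {ψ ψ' : A ⇒ A'} {χ χ' : B ⇒ B'} →
                         IsPullback C f g q₁' q₂' →
                         Componentwise q₁ q₂ q₁' q₂' φ ψ χ →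
                         Componentwise q₁ q₂ q₁' q₂' φ' ψ' χ' →
                         ψ ≈ ψ' → χ ≈ χ' → φ ≈ φ'
  componentwise-unique pb (e₁ , e₂) (e₁' , e₂') ψ≈ψ' χ≈χ' = pullback-jointly-monic pb
    (trans e₁ (trans (ψ≈ψ' ⟩∘⟨refl) (sym e₁')))
    (trans e₂ (trans (χ≈χ' ⟩∘⟨refl) (sym e₂')))

  section-pullback : ∀ {A B D Q} {f : A ⇒ D} {g : B ⇒ D} {p₁ : Q ⇒ A} {p₂ : Q ⇒ B} {a : D ⇒ B} →
                     IsPullback C f g p₁ p₂ → g ∘ a ≈ id →
                     Σ (A ⇒ Q) λ k → (p₁ ∘ k ≈ id) × (p₂ ∘ k ≈ a ∘ f) × IsPullback C a p₂ f k
  section-pullback {A} {_} {D} {Q} {f = f} {g} {p₁} {p₂} {a} pb ga = k , p₁k , p₂k , record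
    { commute = sym p₂k
    ; universal = λ {_} {_} {h₂} _ → p₁ ∘ h₂
    ; p₁∘universal = f-p₁
    ; p₂∘universal = λ {_} {h₁} {h₂} eq → pullback-jointly-monic pb
        (trans (pullˡ p₁k) identityˡ)
        (begin
          p₂ ∘ (k ∘ (p₁ ∘ h₂))   ≈⟨ pullˡ p₂k ⟩
          (a ∘ f) ∘ (p₁ ∘ h₂)    ≈⟨ pullʳ (f-p₁ eq) ⟩
          a ∘ h₁                 ≈⟨ eq ⟩
          p₂ ∘ h₂                ∎)
    ; unique = λ {_} {_} {h₂} _ u _ ku → begin
          u                      ≈⟨ sym identityˡ ⟩
          id ∘ u                 ≈⟨ sym p₁k ⟩∘⟨refl ⟩
          (p₁ ∘ k) ∘ u           ≈⟨ pullʳ ku ⟩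
          p₁ ∘ h₂                ∎
    }
    where
      open IsPullback pb using (commute; universal; p₁∘universal; p₂∘universal)

      k-cone : f ∘ id ≈ g ∘ (a ∘ f)
      k-cone = trans identityʳ (sym (cancelˡ ga))

      k : A ⇒ Q
      k = universal k-cone

      p₁k : p₁ ∘ k ≈ id
      p₁k = p₁∘universal k-cone

      p₂k : p₂ ∘ k ≈ a ∘ f
      p₂k = p₂∘universal k-cone

      f-p₁ : ∀ {X} {h₁ : X ⇒ D} {h₂ : X ⇒ Q} → a ∘ h₁ ≈ p₂ ∘ h₂ → f ∘ (p₁ ∘ h₂) ≈ h₁
      f-p₁ {h₁ = h₁} {h₂} eq = begin
        f ∘ (p₁ ∘ h₂)          ≈⟨ pullˡ commute ⟩
        (g ∘ p₂) ∘ h₂          ≈⟨ pullʳ (sym eq) ⟩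
        g ∘ (a ∘ h₁)           ≈⟨ cancelˡ ga ⟩
        h₁                     ∎

module Pointings {o ℓ e p : Level} (C : Category o ℓ e) (𝕀 : IdTypeCat C p) where
  open Category C
  open IdTypeCat 𝕀
  open CategoryLemmas C
  open Pullback using (apex; p₁; p₂; isPullback)

  ⇑ : Tower C 𝕀 → Tower C 𝕀
  ⇑ = shift C 𝕀

  I-section-pullback : ∀ {A B D Q} {f : A ⇒ D} {g : B ⇒ D} {p₁ : Q ⇒ A} {p₂ : Q ⇒ B} {a : D ⇒ B} →
                       IsPullback C f g p₁ p₂ → P f → I a → g ∘ a ≈ id →
                       Σ (A ⇒ Q) λ k → I k × (p₁ ∘ k ≈ id) × (p₂ ∘ k ≈ a ∘ f)
  I-section-pullback pb fP aI ga =
    let (k , p₁k , p₂k , kpb) = section-pullback pb ga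
    in k , I-stable aI (P-stable fP pb) kpb , p₁k , p₂k

  -- For a list of length ≥ 2, Γ^{π ∷ πs} is the pullback PB T π πs of Γ^{πs}
  -- and (Γ_{+1})^π over Γ₀.
  Splits : ∀ {m n} (T : Tower C 𝕀) (π : Pd m) (πs : List (Pd m)) (ρ : Pd n) (ρs : List (Pd n)) →
           apex (PB C 𝕀 T π πs) ⇒ apex (PB C 𝕀 T ρ ρs) →
           Lim C 𝕀 T πs ⇒ Lim C 𝕀 T ρs → G C 𝕀 (⇑ T) π ⇒ G C 𝕀 (⇑ T) ρ → Set e
  Splits T π πs ρ ρs =
    Componentwise (p₁ (PB C 𝕀 T π πs)) (p₂ (PB C 𝕀 T π πs)) (p₁ (PB C 𝕀 T ρ ρs)) (p₂ (PB C 𝕀 T ρ ρs))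

  lσ-splits : ∀ {n} (T : Tower C 𝕀) (π π' : Pd (suc n)) (πs : List (Pd (suc n))) →
              Splits T π (π' ∷ πs) (∂ π) (∂s (π' ∷ πs))
                (lσ C 𝕀 T (π ∷ π' ∷ πs)) (lσ C 𝕀 T (π' ∷ πs)) (σ C 𝕀 (⇑ T) π)
  lσ-splits T π π' πs = universal-legs (PB C 𝕀 T (∂ π) (∂s (π' ∷ πs))) (lσ-eq C 𝕀 T π (π' ∷ πs))

  lτ-splits : ∀ {n} (T : Tower C 𝕀) (π π' : Pd (suc n)) (πs : List (Pd (suc n))) →
              Splits T π (π' ∷ πs) (∂ π) (∂s (π' ∷ πs))
                (lτ C 𝕀 T (π ∷ π' ∷ πs)) (lτ C 𝕀 T (π' ∷ πs)) (τ C 𝕀 (⇑ T) π)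
  lτ-splits T π π' πs = universal-legs (PB C 𝕀 T (∂ π) (∂s (π' ∷ πs))) (lτ-eq C 𝕀 T π (π' ∷ πs))

  lrp-legs : ∀ {n} (T : Tower C 𝕀) (π π' : Pd n) (πs : List (Pd n)) →
             (p₁ (PB C 𝕀 T π (π' ∷ πs)) ∘ lrp C 𝕀 T (π ∷ π' ∷ πs) ≈ lrp C 𝕀 T (π' ∷ πs)) ×
             (p₂ (PB C 𝕀 T π (π' ∷ πs)) ∘ lrp C 𝕀 T (π ∷ π' ∷ πs) ≈ rp C 𝕀 (⇑ T) π ∘ Tower.r T)
  lrp-legs T π π' πs = universal-legs (PB C 𝕀 T π (π' ∷ πs)) (lrp-eq C 𝕀 T π (π' ∷ πs))

  splits-pointed : ∀ {m n} (T : Tower C 𝕀) (π π' : Pd m) (πs : List (Pd m)) (ρ ρ' : Pd n) (ρs : List (Pd n))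
                     {φ : Lim C 𝕀 T (π ∷ π' ∷ πs) ⇒ Lim C 𝕀 T (ρ ∷ ρ' ∷ ρs)}
                     {ψ : Lim C 𝕀 T (π' ∷ πs) ⇒ Lim C 𝕀 T (ρ' ∷ ρs)} {χ : G C 𝕀 (⇑ T) π ⇒ G C 𝕀 (⇑ T) ρ} →
                   Splits T π (π' ∷ πs) ρ (ρ' ∷ ρs) φ ψ χ →
                   ψ ∘ lrp C 𝕀 T (π' ∷ πs) ≈ lrp C 𝕀 T (ρ' ∷ ρs) →
                   χ ∘ rp C 𝕀 (⇑ T) π ≈ rp C 𝕀 (⇑ T) ρ →
                   φ ∘ lrp C 𝕀 T (π ∷ π' ∷ πs) ≈ lrp C 𝕀 T (ρ ∷ ρ' ∷ ρs)
  splits-pointed T π π' πs ρ ρ' ρs {φ} {ψ} {χ} (φ₁ , φ₂) ψr χr =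
    pullback-jointly-monic (isPullback (PB C 𝕀 T ρ (ρ' ∷ ρs)))
      (begin
        p₁ (PB C 𝕀 T ρ (ρ' ∷ ρs)) ∘ (φ ∘ lrp C 𝕀 T (π ∷ π' ∷ πs))  ≈⟨ pullˡ φ₁ ⟩
        (ψ ∘ p₁ (PB C 𝕀 T π (π' ∷ πs))) ∘ lrp C 𝕀 T (π ∷ π' ∷ πs) ≈⟨ pullʳ (proj₁ (lrp-legs T π π' πs)) ⟩
        ψ ∘ lrp C 𝕀 T (π' ∷ πs)                                    ≈⟨ ψr ⟩
        lrp C 𝕀 T (ρ' ∷ ρs)                                        ≈⟨ sym (proj₁ (lrp-legs T ρ ρ' ρs)) ⟩
        p₁ (PB C 𝕀 T ρ (ρ' ∷ ρs)) ∘ lrp C 𝕀 T (ρ ∷ ρ' ∷ ρs)        ∎)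
      (begin
        p₂ (PB C 𝕀 T ρ (ρ' ∷ ρs)) ∘ (φ ∘ lrp C 𝕀 T (π ∷ π' ∷ πs))  ≈⟨ pullˡ φ₂ ⟩
        (χ ∘ p₂ (PB C 𝕀 T π (π' ∷ πs))) ∘ lrp C 𝕀 T (π ∷ π' ∷ πs) ≈⟨ pullʳ (proj₂ (lrp-legs T π π' πs)) ⟩
        χ ∘ (rp C 𝕀 (⇑ T) π ∘ Tower.r T)                           ≈⟨ pullˡ χr ⟩
        rp C 𝕀 (⇑ T) ρ ∘ Tower.r T                                 ≈⟨ sym (proj₂ (lrp-legs T ρ ρ' ρs)) ⟩
        p₂ (PB C 𝕀 T ρ (ρ' ∷ ρs)) ∘ lrp C 𝕀 T (ρ ∷ ρ' ∷ ρs)        ∎)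

  rbase-lrp : ∀ {n} (T : Tower C 𝕀) (πs : List (Pd n)) → rbase C 𝕀 T πs ∘ lrp C 𝕀 T πs ≈ id
  rbase-lrp T [] = identityˡ
  rbase-lrp T (π ∷ []) = trans (pullʳ (cancelˡ (base-rp C 𝕀 (⇑ T) π))) (Tower.t∘r T)
  rbase-lrp T (π ∷ π' ∷ πs) = trans (pullʳ (proj₁ (lrp-legs T π π' πs))) (rbase-lrp T (π' ∷ πs))

  mutual
    σ-rp : ∀ {n} (T : Tower C 𝕀) (π : Pd (suc n)) → σ C 𝕀 T π ∘ rp C 𝕀 T π ≈ rp C 𝕀 T (∂ π)
    σ-rp {zero} T ⟦ πs ⟧ = lbase-lrp C 𝕀 T πs
    σ-rp {suc n} T ⟦ πs ⟧ = lσ-lrp T πs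

    lσ-lrp : ∀ {n} (T : Tower C 𝕀) (πs : List (Pd (suc n))) →
             lσ C 𝕀 T πs ∘ lrp C 𝕀 T πs ≈ lrp C 𝕀 T (∂s πs)
    lσ-lrp T [] = identityˡ
    lσ-lrp T (π ∷ []) = pullˡ (σ-rp (⇑ T) π)
    lσ-lrp T (π ∷ π' ∷ πs) = splits-pointed T π π' πs (∂ π) (∂ π') (∂s πs)
      (lσ-splits T π π' πs) (lσ-lrp T (π' ∷ πs)) (σ-rp (⇑ T) π)

  mutual
    τ-rp : ∀ {n} (T : Tower C 𝕀) (π : Pd (suc n)) → τ C 𝕀 T π ∘ rp C 𝕀 T π ≈ rp C 𝕀 T (∂ π)
    τ-rp {zero} T ⟦ πs ⟧ = rbase-lrp T πs
    τ-rp {suc n} T ⟦ πs ⟧ = lτ-lrp T πs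

    lτ-lrp : ∀ {n} (T : Tower C 𝕀) (πs : List (Pd (suc n))) →
             lτ C 𝕀 T πs ∘ lrp C 𝕀 T πs ≈ lrp C 𝕀 T (∂s πs)
    lτ-lrp T [] = identityˡ
    lτ-lrp T (π ∷ []) = pullˡ (τ-rp (⇑ T) π)
    lτ-lrp T (π ∷ π' ∷ πs) = splits-pointed T π π' πs (∂ π) (∂ π') (∂s πs)
      (lτ-splits T π π' πs) (lτ-lrp T (π' ∷ πs)) (τ-rp (⇑ T) π)

  lσ-rbase : ∀ {n} (T : Tower C 𝕀) (πs : List (Pd (suc n))) →
             rbase C 𝕀 T (∂s πs) ∘ lσ C 𝕀 T πs ≈ rbase C 𝕀 T πs
  lσ-rbase T [] = identityˡ
  lσ-rbase T (π ∷ []) = pullʳ (σ-base C 𝕀 (⇑ T) π)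
  lσ-rbase T (π ∷ π' ∷ πs) =
    trans (pullʳ (proj₁ (lσ-splits T π π' πs))) (pullˡ (lσ-rbase T (π' ∷ πs)))

  lτ-rbase : ∀ {n} (T : Tower C 𝕀) (πs : List (Pd (suc n))) →
             rbase C 𝕀 T (∂s πs) ∘ lτ C 𝕀 T πs ≈ rbase C 𝕀 T πs
  lτ-rbase T [] = identityˡ
  lτ-rbase T (π ∷ []) = trans assoc (τ-base-t C 𝕀 T π)
  lτ-rbase T (π ∷ π' ∷ πs) =
    trans (pullʳ (proj₁ (lτ-splits T π π' πs))) (pullˡ (lτ-rbase T (π' ∷ πs)))

  mutual
    glob-s : ∀ {n} (T : Tower C 𝕀) (π : Pd (suc (suc n))) →
             σ C 𝕀 T (∂ π) ∘ σ C 𝕀 T π ≈ σ C 𝕀 T (∂ π) ∘ τ C 𝕀 T π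
    glob-s {zero} T ⟦ πs ⟧ = trans (lσ-base C 𝕀 T πs) (sym (lτ-base C 𝕀 T πs))
    glob-s {suc n} T ⟦ πs ⟧ = lglob-s T πs

    lglob-s : ∀ {n} (T : Tower C 𝕀) (πs : List (Pd (suc (suc n)))) →
              lσ C 𝕀 T (∂s πs) ∘ lσ C 𝕀 T πs ≈ lσ C 𝕀 T (∂s πs) ∘ lτ C 𝕀 T πs
    lglob-s T [] = refl
    lglob-s T (π ∷ []) = glob-s (⇑ T) π
    lglob-s T (π ∷ π' ∷ πs) =
      componentwise-unique (isPullback (PB C 𝕀 T (∂ (∂ π)) (∂s (∂s (π' ∷ πs)))))
        (componentwise-∘ (lσ-splits T (∂ π) (∂ π') (∂s πs)) (lσ-splits T π π' πs))
        (componentwise-∘ (lσ-splits T (∂ π) (∂ π') (∂s πs)) (lτ-splits T π π' πs))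
        (lglob-s T (π' ∷ πs)) (glob-s (⇑ T) π)

  mutual
    glob-t : ∀ {n} (T : Tower C 𝕀) (π : Pd (suc (suc n))) →
             τ C 𝕀 T (∂ π) ∘ σ C 𝕀 T π ≈ τ C 𝕀 T (∂ π) ∘ τ C 𝕀 T π
    glob-t {zero} T ⟦ πs ⟧ = trans (lσ-rbase T πs) (sym (lτ-rbase T πs))
    glob-t {suc n} T ⟦ πs ⟧ = lglob-t T πs

    lglob-t : ∀ {n} (T : Tower C 𝕀) (πs : List (Pd (suc (suc n)))) →
              lτ C 𝕀 T (∂s πs) ∘ lσ C 𝕀 T πs ≈ lτ C 𝕀 T (∂s πs) ∘ lτ C 𝕀 T πs
    lglob-t T [] = refl
    lglob-t T (π ∷ []) = glob-t (⇑ T) π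
    lglob-t T (π ∷ π' ∷ πs) =
      componentwise-unique (isPullback (PB C 𝕀 T (∂ (∂ π)) (∂s (∂s (π' ∷ πs)))))
        (componentwise-∘ (lτ-splits T (∂ π) (∂ π') (∂s πs)) (lσ-splits T π π' πs))
        (componentwise-∘ (lτ-splits T (∂ π) (∂ π') (∂s πs)) (lτ-splits T π π' πs))
        (lglob-t T (π' ∷ πs)) (glob-t (⇑ T) π)

  lrp-factor : ∀ {n} (T : Tower C 𝕀) (π π' : Pd n) (πs : List (Pd n))
                 {k : Lim C 𝕀 T (π' ∷ πs) ⇒ Lim C 𝕀 T (π ∷ π' ∷ πs)} →
               p₁ (PB C 𝕀 T π (π' ∷ πs)) ∘ k ≈ id →
               p₂ (PB C 𝕀 T π (π' ∷ πs)) ∘ k ≈ (rp C 𝕀 (⇑ T) π ∘ Tower.r T) ∘ lbase C 𝕀 T (π' ∷ πs) →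
               k ∘ lrp C 𝕀 T (π' ∷ πs) ≈ lrp C 𝕀 T (π ∷ π' ∷ πs)
  lrp-factor T π π' πs p₁k p₂k = pullback-jointly-monic (isPullback (PB C 𝕀 T π (π' ∷ πs)))
    (trans (cancelˡ p₁k) (sym (proj₁ (lrp-legs T π π' πs))))
    (trans (pullˡ p₂k) (trans (pullʳ (lbase-lrp C 𝕀 T (π' ∷ πs)))
      (trans identityʳ (sym (proj₂ (lrp-legs T π π' πs))))))

  mutual
    rp-I : ∀ {n} (T : Tower C 𝕀) → (∀ {k} → I (Tower.r T {k})) → (π : Pd n) → I (rp C 𝕀 T π)
    rp-I T rI ⋆ = I-id
    rp-I T rI ⟦ πs ⟧ = lrp-I T rI πs

    lrp-I : ∀ {n} (T : Tower C 𝕀) → (∀ {k} → I (Tower.r T {k})) → (πs : List (Pd n)) →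
            I (lrp C 𝕀 T πs)
    lrp-I T rI [] = I-id
    lrp-I T rI (π ∷ []) = I-∘ (rp-I (⇑ T) rI π) rI
    lrp-I T rI (π ∷ π' ∷ πs) =
      let (k , kI , p₁k , p₂k) = I-section-pullback (isPullback (PB C 𝕀 T π (π' ∷ πs)))
                                   (lbase-P C 𝕀 T (π' ∷ πs)) (I-∘ (rp-I (⇑ T) rI π) rI)
                                   (rbase-lrp T (π ∷ []))
      in I-resp (lrp-factor T π π' πs p₁k p₂k) (I-∘ kI (lrp-I T rI (π' ∷ πs)))

  rι-face : (T : Tower C 𝕀) (d : ∀ {n} → Tower.obj T (suc n) ⇒ Tower.obj T n) →
            (∀ {n} → d ∘ Tower.r T {n} ≈ id) →
            (j : ℕ) → d ∘ Endo.rι C 𝕀 T (suc j) ≈ Endo.rι C 𝕀 T j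
  rι-face T d dr zero = begin
    d ∘ (id ∘ (id ∘ Tower.r T))  ≈⟨ refl⟩∘⟨ trans identityˡ identityˡ ⟩
    d ∘ Tower.r T                ≈⟨ dr ⟩
    id                           ≈⟨ sym identityˡ ⟩
    id ∘ id                      ∎
  rι-face T d dr (suc j) = begin
    d ∘ Endo.rι C 𝕀 T (suc (suc j))              ≈⟨ refl⟩∘⟨ sym assoc ⟩
    d ∘ (Endo.rι C 𝕀 (⇑ T) (suc j) ∘ Tower.r T)  ≈⟨ pullˡ (rι-face (⇑ T) d dr j) ⟩
    Endo.rι C 𝕀 (⇑ T) j ∘ Tower.r T              ≈⟨ assoc ⟩
    Endo.rι C 𝕀 T (suc j)                        ∎

module PointedSuboperad {o ℓ e p : Level} (C : Category o ℓ e) (𝕀 : IdTypeCat C p)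
                        (𝔾 : GlobularContext C 𝕀) (R : Reflexive C 𝕀 𝔾) where
  open Category C
  open IdTypeCat 𝕀 hiding (⊤)
  open GlobularContext 𝔾
  open CategoryLemmas C
  open Pointings C 𝕀

  T : Tower C 𝕀
  T = tower C 𝕀 𝔾 R

  open Endo C 𝕀 T

  rI : ∀ {n} → I (Tower.r T {n})
  rI {n} = Reflexive.r-I R n

  B-jointly-monic : ∀ n {X} {u v : X ⇒ B n} → pr₁ n ∘ u ≈ pr₁ n ∘ v → pr₂ n ∘ u ≈ pr₂ n ∘ v → u ≈ v
  B-jointly-monic zero = pullback-jointly-monic B-zero
  B-jointly-monic (suc n) = pullback-jointly-monic (B-suc n)

  ⟨s,t⟩-agree : ∀ n {X} {x y : X ⇒ Γ (suc n)} → s ∘ x ≈ s ∘ y → t ∘ x ≈ t ∘ y →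
                ⟨s,t⟩ n ∘ x ≈ ⟨s,t⟩ n ∘ y
  ⟨s,t⟩-agree n e₁ e₂ = B-jointly-monic n
    (trans (pullˡ (pr₁∘⟨s,t⟩ n)) (trans e₁ (sym (pullˡ (pr₁∘⟨s,t⟩ n)))))
    (trans (pullˡ (pr₂∘⟨s,t⟩ n)) (trans e₂ (sym (pullˡ (pr₂∘⟨s,t⟩ n)))))

  -- x, y : X → Γ_n are parallel if they have common source and target (n ≥ 1);
  -- exactly then they pair to a map into B_nΓ.
  Parallel : ∀ n {X} → X ⇒ Γ n → X ⇒ Γ n → Set e
  Parallel zero x y = ⊤
  Parallel (suc n) x y = (s ∘ x ≈ s ∘ y) × (t ∘ x ≈ t ∘ y)

  pairing : ∀ n {X} {x y : X ⇒ Γ n} → Parallel n x y →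
            Σ (X ⇒ B n) λ u → (pr₁ n ∘ u ≈ x) × (pr₂ n ∘ u ≈ y)
  pairing zero _ = pair B-zero (trans (!-unique _) (sym (!-unique _)))
  pairing (suc n) (e₁ , e₂) = pair (B-suc n) (⟨s,t⟩-agree n e₁ e₂)

  pointed-leg : ∀ {n} (π : Pd (suc n)) {u : Γ^ π ⇒ B n} {pr : B n ⇒ Γ n} {d : Γ (suc n) ⇒ Γ n}
                  {F : Γ^ (∂ π) ⇒ Γ n} {face : Γ^ π ⇒ Γ^ (∂ π)} →
                pr ∘ ⟨s,t⟩ n ≈ d → d ∘ rι (suc n) ≈ rι n →
                pr ∘ u ≈ F ∘ face → face ∘ rp C 𝕀 T π ≈ rp C 𝕀 T (∂ π) → F ∘ rp C 𝕀 T (∂ π) ≈ rι n →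
                pr ∘ (u ∘ rp C 𝕀 T π) ≈ pr ∘ (⟨s,t⟩ n ∘ rι (suc n))
  pointed-leg {n} π {u} {pr} {d} {F} {face} pr-d d-r u-F face-r F-r = begin
    pr ∘ (u ∘ rp C 𝕀 T π)       ≈⟨ pullˡ u-F ⟩
    (F ∘ face) ∘ rp C 𝕀 T π     ≈⟨ pullʳ face-r ⟩
    F ∘ rp C 𝕀 T (∂ π)          ≈⟨ F-r ⟩
    rι n                        ≈⟨ sym d-r ⟩
    d ∘ rι (suc n)              ≈⟨ sym (pullˡ pr-d) ⟩
    pr ∘ (⟨s,t⟩ n ∘ rι (suc n)) ∎

  -- The lifting step: pointed, parallel boundary data (F σ, H τ) has a pointed
  -- filler h, a diagonal of the square (r_π, r_{ι_{n+1}}; u, (s,t)).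
  fill : ∀ {n} (π : Pd (suc n)) {F H : Γ^ (∂ π) ⇒ Γ n} →
         Parallel n (F ∘ σ C 𝕀 T π) (H ∘ τ C 𝕀 T π) →
         F ∘ rp C 𝕀 T (∂ π) ≈ rι n → H ∘ rp C 𝕀 T (∂ π) ≈ rι n →
         Σ (Γ^ π ⇒ Γ (suc n)) λ h →
           ((s ∘ h ≈ F ∘ σ C 𝕀 T π) × (t ∘ h ≈ H ∘ τ C 𝕀 T π)) × (h ∘ rp C 𝕀 T π ≈ rι (suc n))
  fill {n} π parallel F-r H-r =
    let (u , u₁ , u₂) = pairing n parallel
        square : u ∘ rp C 𝕀 T π ≈ ⟨s,t⟩ n ∘ rι (suc n)
        square = B-jointly-monic n
          (pointed-leg π (pr₁∘⟨s,t⟩ n) (rι-face T s (Tower.s∘r T) n) u₁ (σ-rp T π) F-r)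
          (pointed-leg π (pr₂∘⟨s,t⟩ n) (rι-face T t (Tower.t∘r T) n) u₂ (τ-rp T π) H-r)
        (h , h-r , st-h) = lift (rp-I T rI π) (⟨s,t⟩-P n) square
    in h , ( trans (sym (pr₁∘⟨s,t⟩ n) ⟩∘⟨refl) (trans (pullʳ st-h) u₁)
           , trans (sym (pr₂∘⟨s,t⟩ n) ⟩∘⟨refl) (trans (pullʳ st-h) u₂) )
         , h-r

  heads-pointed : ∀ {m} {ρ : Pd m} (b : Bnd ρ) → BndOK b →
                  (bfst b ∘ rp C 𝕀 T ρ ≈ rι m) × (bsnd b ∘ rp C 𝕀 T ρ ≈ rι m)
  heads-pointed (bnd₀ _ _) ok = ok
  heads-pointed (bndₛ _ _ _ _ _) (_ , f-r , g-r) = f-r , g-r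

  extend : ∀ {n} (π : Pd (suc n)) (b : Bnd (∂ π)) → BndOK b →
           Parallel n (bfst b ∘ σ C 𝕀 T π) (bsnd b ∘ τ C 𝕀 T π) → PElt π
  extend π b ok parallel =
    let (h , compat , h-r) = fill π parallel (proj₁ (heads-pointed b ok)) (proj₂ (heads-pointed b ok))
    in opₛ b h compat , ok , h-r

  normalised : Normalised
  normalised = (op₀ (rι 0) , identityʳ) , λ { (op₀ f , f-r) → trans (sym identityʳ) f-r }

  fst-≈ : ∀ {m} {ρ : Pd m} (b b' : Bnd ρ) → OpEq (fstOp b) (fstOp b') → bfst b ≈ bfst b'
  fst-≈ (bnd₀ _ _) (bnd₀ _ _) e = e
  fst-≈ (bndₛ _ _ _ _ _) (bndₛ _ _ _ _ _) (_ , e) = e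

  snd-≈ : ∀ {m} {ρ : Pd m} (b b' : Bnd ρ) → OpEq (sndOp b) (sndOp b') → bsnd b ≈ bsnd b'
  snd-≈ (bnd₀ _ _) (bnd₀ _ _) e = e
  snd-≈ (bndₛ _ _ _ _ _) (bndₛ _ _ _ _ _) (_ , e) = e

  bnd-≈ : ∀ {m} {ρ : Pd m} (b b' : Bnd ρ) → OpEq (fstOp b) (fstOp b') → OpEq (sndOp b) (sndOp b') →
          BndEq b b'
  bnd-≈ (bnd₀ _ _) (bnd₀ _ _) e₁ e₂ = e₁ , e₂
  bnd-≈ (bndₛ _ _ _ _ _) (bndₛ _ _ _ _ _) (eb , e₁) (_ , e₂) = eb , e₁ , e₂

  bnd-refl : ∀ {m} {ρ : Pd m} (b : Bnd ρ) → BndEq b b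
  bnd-refl (bnd₀ _ _) = refl , refl
  bnd-refl (bndₛ b _ _ _ _) = bnd-refl b , refl , refl

  recompat : ∀ {m} {ρ : Pd (suc m)} (b b' : Bnd (∂ ρ)) {f : Γ^ ρ ⇒ Γ (suc m)} →
             bfst b ≈ bfst b' → bsnd b ≈ bsnd b' → Compat ρ b' f → Compat ρ b f
  recompat b b' fst≈ snd≈ (f-s , f-t) = trans f-s (sym fst≈ ⟩∘⟨refl) , trans f-t (sym snd≈ ⟩∘⟨refl)

  -- One face of the parallelism of (f₁ σ, f₂ τ): uses the globularity φσ = φτ
  -- of the face φ ∈ {σ, τ} of ∂π.
  glob-face : ∀ {n} (π : Pd (suc (suc n))) {d : Γ (suc n) ⇒ Γ n} {f₁ f₂ : Γ^ (∂ π) ⇒ Γ (suc n)}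
                {x₁ x₂ : Γ^ (∂ (∂ π)) ⇒ Γ n} {φ : Γ^ (∂ π) ⇒ Γ^ (∂ (∂ π))} →
              d ∘ f₁ ≈ x₁ ∘ φ → d ∘ f₂ ≈ x₂ ∘ φ → x₁ ≈ x₂ →
              φ ∘ σ C 𝕀 T π ≈ φ ∘ τ C 𝕀 T π →
              d ∘ (f₁ ∘ σ C 𝕀 T π) ≈ d ∘ (f₂ ∘ τ C 𝕀 T π)
  glob-face π {d} {f₁} {f₂} {x₁} {x₂} {φ} e₁ e₂ x≈ glob = begin
    d ∘ (f₁ ∘ σ C 𝕀 T π)   ≈⟨ pullˡ e₁ ⟩
    (x₁ ∘ φ) ∘ σ C 𝕀 T π   ≈⟨ pullʳ glob ⟩
    x₁ ∘ (φ ∘ τ C 𝕀 T π)   ≈⟨ x≈ ⟩∘⟨refl ⟩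
    x₂ ∘ (φ ∘ τ C 𝕀 T π)   ≈⟨ sym (trans (pullˡ e₂) assoc) ⟩
    d ∘ (f₂ ∘ τ C 𝕀 T π)   ∎

  -- Dimension 1: any two pointed 0-cells bound a pointed 1-cell (B₁Γ = Γ₀ × Γ₀).
  contractible-dim1 : (π : Pd 1) (θ₁ θ₂ : PElt (∂ π)) →
                      Σ (PElt π) λ ϕ → OpEq (src (proj₁ ϕ)) (proj₁ θ₁) × OpEq (tgt (proj₁ ϕ)) (proj₁ θ₂)
  contractible-dim1 ⟦ πs ⟧ (op₀ f , f-r) (op₀ g , g-r) = extend ⟦ πs ⟧ (bnd₀ f g) (f-r , g-r) tt , refl , refl

  -- Dimension ≥ 2: parallel pointed cells θ₁, θ₂ bound a pointed cell; the
  -- boundary (θ₁'s boundary; f₁, f₂) is parallel by (2).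
  contractible-dim≥2 : ∀ {n} (π : Pd (suc (suc n))) (θ₁ θ₂ : PElt (∂ π)) →
                       OpEq (src (proj₁ θ₁)) (src (proj₁ θ₂)) → OpEq (tgt (proj₁ θ₁)) (tgt (proj₁ θ₂)) →
                       Σ (PElt π) λ ϕ → OpEq (src (proj₁ ϕ)) (proj₁ θ₁) × OpEq (tgt (proj₁ ϕ)) (proj₁ θ₂)
  contractible-dim≥2 π (opₛ b₁ f₁ c₁ , b₁-ok , f₁-r) (opₛ b₂ f₂ c₂ , _ , f₂-r) src≈ tgt≈ =
    extend π (bndₛ b₁ f₁ f₂ c₁ (recompat b₁ b₂ fst≈ snd≈ c₂)) (b₁-ok , f₁-r , f₂-r)
      ( glob-face π (proj₁ c₁) (proj₁ c₂) fst≈ (glob-s T π)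
      , glob-face π (proj₂ c₁) (proj₂ c₂) snd≈ (glob-t T π) )
    , (bnd-refl b₁ , refl) , (bnd-≈ b₁ b₂ src≈ tgt≈ , refl)
    where
      fst≈ : bfst b₁ ≈ bfst b₂
      fst≈ = fst-≈ b₁ b₂ src≈
      snd≈ : bsnd b₁ ≈ bsnd b₂
      snd≈ = snd-≈ b₁ b₂ tgt≈

  contractible : Contractible
  contractible = contractible-dim1 , contractible-dim≥2

proposition3p4p7 : ∀ {o ℓ e p : Level} (C : Category o ℓ e) (𝕀 : IdTypeCat C p)
                     (Γ : GlobularContext C 𝕀) (R : Reflexive C 𝕀 Γ) →
                     PointedSuboperadNormalised C 𝕀 Γ R × PointedSuboperadContractible C 𝕀 Γ R
proposition3p4p7 C 𝕀 Γ R =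
  PointedSuboperad.normalised C 𝕀 Γ R , PointedSuboperad.contractible C 𝕀 Γ R
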